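{- Let $R\subseteq[n]$ be nonempty and define $f_R:2^{[n]}\to\mathbb{R}$ by $f_R(S)=-1$ if $S=R$, $f_R(S)=0$ if $S\subsetneq R$ or $R\subsetneq S$, and $f_R(S)=1$ otherwise. Let $P$ be a permutation of $[n]$ and let $g$ be the corresponding Lovasz subgradient, $g_{P_m}=f_R(P[m])-f_R(P[m-1])$ for $m\in[n]$. Let $i\in[n]$ be the smallest index such that $P[i]$ is not a subset of $R$ (if it exists), and let $j\in[n]$ be the smallest index such that $P[j]$ is a superset of $R$. Then $g_{P_i}=1$ (when $i$ exists), $g_{P_j}=-1$, and $g_{P_m}=0$ for all other $m\in[n]$.
   Context: $P[m]=\{P_1,\dots,P_m\}$ and $P[0]=\emptyset$. -}

module Defs where

open import Data.Bool using (Bool; if_then_else_; _∨_)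
open import Data.Bool.Properties using () renaming (_≟_ to _≟ᵇ_)
open import Data.Nat using (ℕ; suc; _<ᵇ_; _<_)
open import Data.Integer using (ℤ; +_; -_; _-_)
open import Data.Fin using (Fin; toℕ)
open import Data.Fin.Subset using (Subset; _⊆_)
open import Data.Fin.Subset.Properties using (_⊆?_)
open import Data.Fin.Permutation using (Permutation′; _⟨$⟩ʳ_; _⟨$⟩ˡ_)
open import Data.Vec using (tabulate)
open import Data.Vec.Properties using (≡-dec)
open import Data.Product using (_×_)
open import Relation.Nullary using (¬_; does)

-- Ground set [n] is Fin n; positions 1..n of the permutation are Fin n
-- (position m : Fin n stands for the 1-based index suc (toℕ m)).
-- P ⟨$⟩ʳ m is the element P_{m+1}; P ⟨$⟩ˡ x is the (0-based) position of x.

prefix : ∀ {n} → Permutation′ n → ℕ → Subset n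
prefix P k = tabulate (λ x → toℕ (P ⟨$⟩ˡ x) <ᵇ k)

fR : ∀ {n} → Subset n → Subset n → ℤ
fR R S =
  if does (≡-dec _≟ᵇ_ S R) then - (+ 1)
  else if (does (S ⊆? R) ∨ does (R ⊆? S)) then + 0
  else + 1

-- Lovász subgradient: g_{P_m} = f_R(P[m]) - f_R(P[m-1]), indexed by elements x = P_m.
lovaszGrad : ∀ {n} → Subset n → Permutation′ n → Fin n → ℤ
lovaszGrad R P x = fR R (prefix P (suc (toℕ (P ⟨$⟩ˡ x)))) - fR R (prefix P (toℕ (P ⟨$⟩ˡ x)))

IsLeastIndex : ∀ {n} → (Subset n → Set) → Permutation′ n → Fin n → Set
IsLeastIndex {n} Q P k =
  Q (prefix P (suc (toℕ k))) × (∀ (l : Fin n) → toℕ l < toℕ k → ¬ Q (prefix P (suc (toℕ l))))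

NotSubsetOf : ∀ {n} → Subset n → Subset n → Set
NotSubsetOf R S = ¬ (S ⊆ R)

SupersetOf : ∀ {n} → Subset n → Subset n → Set
SupersetOf R S = R ⊆ S

module Submission where

-- Write A = P[m-1] and B = P[m] for the two consecutive
-- prefixes of the permutation, so that B = A ∪ {P_m} and g_{P_m} = f_R(B) - f_R(A).
-- The value f_R(S) depends only on the two truth values "S ⊆ R" and "R ⊆ S"
-- (-1 if both hold, 0 if exactly one holds, 1 if neither holds), and along the
-- chain of prefixes "S ⊈ R" and "R ⊆ S" are both upward closed.  Hence
--   * if neither property switches on between A and B, the gradient is 0;
--   * since B adds a single element x, at most one of them can switch on
--     (x ∉ R when "⊈ R" switches on, x ∈ R when "⊇ R" does), and the gradient
--     is then +1 resp. -1.
-- Finally, for an upward closed property that fails on P[0] = ∅ (as both do,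
-- R being nonempty), "m is the least index where it holds" means exactly that
-- it switches on between P[m-1] and P[m].

open import Defs
open import Data.Nat using (ℕ; suc; _<_; _≤_; s≤s)
open import Data.Nat.Properties using (<ᵇ⇒<; <⇒<ᵇ; m<1+n⇒m<n∨m≡n; <-≤-trans; n≤1+n; ≤-reflexive)
open import Data.Integer using (ℤ; +_; -_; _-_)
open import Data.Integer.Properties using (+-inverseʳ)
open import Data.Bool using (Bool; true; false)
open import Data.Bool.Properties using (T-≡) renaming (_≟_ to _≟ᵇ_)
open import Data.Fin using (Fin; zero; suc; toℕ; inject₁)
open import Data.Fin.Properties using (toℕ-injective; toℕ-inject₁)
open import Data.Fin.Subset using (Subset; Nonempty; _∈_; _∉_; _⊆_; _∪_; ⁅_⁆)
open import Data.Fin.Subset.Properties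
  using (_⊆?_; ⊆-refl; ⊆-trans; ⊆-antisym; _∈?_; x∈p∪q⁺; x∈p∪q⁻; x∈⁅x⁆; x∈⁅y⁆⇒x≡y)
open import Data.Fin.Permutation using (Permutation′; _⟨$⟩ʳ_; _⟨$⟩ˡ_; inverseˡ; inverseʳ)
open import Data.Vec.Properties using (≡-dec; lookup∘tabulate; []=⇒lookup; lookup⇒[]=)
open import Data.Product using (_×_; _,_)
open import Data.Sum using (inj₁; inj₂)
open import Data.Empty using (⊥-elim)
open import Function using (_∘_)
open import Function.Bundles using (Equivalence; mk⇔)
open import Relation.Nullary using (¬_; does; yes; no)
open import Relation.Nullary.Decidable using (dec-true; dec-false; does-⇔; decidable-stable)
open import Relation.Binary.PropositionalEquality
  using (_≡_; refl; sym; trans; cong; cong₂; subst; module ≡-Reasoning)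

open ≡-Reasoning

level : Bool → Bool → ℤ
level true  true  = - (+ 1)
level true  false = + 0
level false true  = + 0
level false false = + 1

fR-level : ∀ {n} (R S : Subset n) → fR R S ≡ level (does (S ⊆? R)) (does (R ⊆? S))
fR-level R S with ≡-dec _≟ᵇ_ S R | S ⊆? R | R ⊆? S
... | yes refl | yes _    | yes _    = refl
... | yes refl | no S⊈S   | _        = ⊥-elim (S⊈S ⊆-refl)
... | yes refl | yes _    | no S⊈S   = ⊥-elim (S⊈S ⊆-refl)
... | no S≢R   | yes S⊆R  | yes R⊆S  = ⊥-elim (S≢R (⊆-antisym S⊆R R⊆S))
... | no _     | yes _    | no _     = refl
... | no _     | no _     | yes _    = refl
... | no _     | no _     | no _     = refl

level-leave-below : ∀ c → level false c - level true c ≡ + 1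
level-leave-below true  = refl
level-leave-below false = refl

level-reach-above : ∀ c → level c true - level c false ≡ - (+ 1)
level-reach-above true  = refl
level-reach-above false = refl

jump : ∀ {n} → Subset n → Subset n → Subset n → ℤ
jump R A B = fR R B - fR R A

Crosses : ∀ {n} → (Subset n → Set) → Subset n → Subset n → Set
Crosses Q A B = Q B × ¬ Q A

module Increment {n} (R A B : Subset n) (A⊆B : A ⊆ B) where

  A-below A-above B-below B-above : Bool
  A-below = does (A ⊆? R)
  A-above = does (R ⊆? A)
  B-below = does (B ⊆? R)
  B-above = does (R ⊆? B)

  jump-level : jump R A B ≡ level B-below B-above - level A-below A-above
  jump-level = cong₂ _-_ (fR-level R B) (fR-level R A)

  -- If neither "⊈ R" nor "⊇ R" switches on, both inclusions are unchanged.
  jump-flat : ¬ Crosses (NotSubsetOf R) A B → ¬ Crosses (SupersetOf R) A B →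
              jump R A B ≡ + 0
  jump-flat ¬leave ¬reach = begin
    jump R A B                                  ≡⟨ jump-level ⟩
    level B-below B-above - level A-below A-above
      ≡⟨ cong₂ (λ b c → level b c - level A-below A-above) same-below same-above ⟩
    level A-below A-above - level A-below A-above ≡⟨ +-inverseʳ (level A-below A-above) ⟩
    + 0                                         ∎
    where
    same-below : B-below ≡ A-below
    same-below = does-⇔ (mk⇔ (⊆-trans A⊆B) below) (B ⊆? R) (A ⊆? R)
      where
      below : A ⊆ R → B ⊆ R
      below A⊆R = decidable-stable (B ⊆? R) (λ B⊈R → ¬leave (B⊈R , λ A⊈R → A⊈R A⊆R))
    same-above : B-above ≡ A-above
    same-above = does-⇔ (mk⇔ above (λ R⊆A → ⊆-trans R⊆A A⊆B)) (R ⊆? B) (R ⊆? A)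
      where
      above : R ⊆ B → R ⊆ A
      above R⊆B = decidable-stable (R ⊆? A) (λ R⊈A → ¬reach (R⊆B , R⊈A))

  -- When B adds a single element x to A, at most one inclusion can change.
  module OnePoint (x : Fin n) (B⊆A∪x : B ⊆ A ∪ ⁅ x ⁆) where

    stays-below : x ∈ R → A ⊆ R → B ⊆ R
    stays-below x∈R A⊆R y∈B with x∈p∪q⁻ A ⁅ x ⁆ (B⊆A∪x y∈B)
    ... | inj₁ y∈A = A⊆R y∈A
    ... | inj₂ y∈x = subst (_∈ R) (sym (x∈⁅y⁆⇒x≡y x y∈x)) x∈R

    stays-short : x ∉ R → R ⊆ B → R ⊆ A
    stays-short x∉R R⊆B y∈R with x∈p∪q⁻ A ⁅ x ⁆ (B⊆A∪x (R⊆B y∈R))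
    ... | inj₁ y∈A = y∈A
    ... | inj₂ y∈x = ⊥-elim (x∉R (subst (_∈ R) (x∈⁅y⁆⇒x≡y x y∈x) y∈R))

    -- Crossing out of the subsets of R: x ∉ R, so "R ⊆ ·" is unchanged.
    jump-leave-below : Crosses (NotSubsetOf R) A B → jump R A B ≡ + 1
    jump-leave-below (B⊈R , ¬A⊈R) = begin
      jump R A B                                  ≡⟨ jump-level ⟩
      level B-below B-above - level A-below A-above
        ≡⟨ cong₂ (λ b a → level b B-above - level a A-above)
                 (dec-false (B ⊆? R) B⊈R) (dec-true (A ⊆? R) A⊆R) ⟩
      level false B-above - level true A-above    ≡⟨ cong (λ c → level false c - level true A-above) same-above ⟩
      level false A-above - level true A-above    ≡⟨ level-leave-below A-above ⟩
      + 1                                         ∎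
      where
      A⊆R : A ⊆ R
      A⊆R = decidable-stable (A ⊆? R) ¬A⊈R
      x∉R : x ∉ R
      x∉R x∈R = B⊈R (stays-below x∈R A⊆R)
      same-above : B-above ≡ A-above
      same-above = does-⇔ (mk⇔ (stays-short x∉R) (λ R⊆A → ⊆-trans R⊆A A⊆B)) (R ⊆? B) (R ⊆? A)

    -- Crossing into the supersets of R: x ∈ R, so "· ⊆ R" is unchanged.
    jump-reach-above : Crosses (SupersetOf R) A B → jump R A B ≡ - (+ 1)
    jump-reach-above (R⊆B , R⊈A) = begin
      jump R A B                                  ≡⟨ jump-level ⟩
      level B-below B-above - level A-below A-above
        ≡⟨ cong₂ (λ b a → level B-below b - level A-below a)
                 (dec-true (R ⊆? B) R⊆B) (dec-false (R ⊆? A) R⊈A) ⟩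
      level B-below true - level A-below false    ≡⟨ cong (λ c → level c true - level A-below false) same-below ⟩
      level A-below true - level A-below false    ≡⟨ level-reach-above A-below ⟩
      - (+ 1)                                     ∎
      where
      x∈R : x ∈ R
      x∈R = decidable-stable (x ∈? R) (λ x∉R → R⊈A (stays-short x∉R R⊆B))
      same-below : B-below ≡ A-below
      same-below = does-⇔ (mk⇔ (⊆-trans A⊆B) (stays-below x∈R)) (B ⊆? R) (A ⊆? R)

module _ {n} (P : Permutation′ n) where

  position : Fin n → ℕ
  position y = toℕ (P ⟨$⟩ˡ y)

  ∈prefix⇒ : ∀ {k y} → y ∈ prefix P k → position y < k
  ∈prefix⇒ {k} {y} y∈ = <ᵇ⇒< (position y) k
    (Equivalence.from T-≡ (trans (sym (lookup∘tabulate _ y)) ([]=⇒lookup y∈)))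

  ∈prefix⇐ : ∀ {k y} → position y < k → y ∈ prefix P k
  ∈prefix⇐ {k} {y} y<k = lookup⇒[]= y _
    (trans (lookup∘tabulate _ y) (Equivalence.to T-≡ (<⇒<ᵇ y<k)))

  prefix-empty : ∀ {y} → y ∉ prefix P 0
  prefix-empty y∈ with ∈prefix⇒ {0} y∈
  ... | ()

  prefix-mono : ∀ {k k′} → k ≤ k′ → prefix P k ⊆ prefix P k′
  prefix-mono k≤k′ y∈ = ∈prefix⇐ (<-≤-trans (∈prefix⇒ y∈) k≤k′)

  prefix-step : ∀ m → prefix P (suc (toℕ m)) ⊆ prefix P (toℕ m) ∪ ⁅ P ⟨$⟩ʳ m ⁆
  prefix-step m {y} y∈ with m<1+n⇒m<n∨m≡n (∈prefix⇒ y∈)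
  ... | inj₁ y<m = x∈p∪q⁺ (inj₁ (∈prefix⇐ y<m))
  ... | inj₂ y≡m = x∈p∪q⁺ (inj₂ (subst (_∈ ⁅ P ⟨$⟩ʳ m ⁆) y-is-Pm (x∈⁅x⁆ (P ⟨$⟩ʳ m))))
    where
    y-is-Pm : P ⟨$⟩ʳ m ≡ y
    y-is-Pm = trans (cong (P ⟨$⟩ʳ_) (sym (toℕ-injective y≡m))) (inverseʳ P)

  lovaszGrad-jump : ∀ R m →
    lovaszGrad R P (P ⟨$⟩ʳ m) ≡ jump R (prefix P (toℕ m)) (prefix P (suc (toℕ m)))
  lovaszGrad-jump R m = cong (λ k → jump R (prefix P k) (prefix P (suc k))) (cong toℕ (inverseˡ P))

UpwardClosed : ∀ {n} → (Subset n → Set) → Set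
UpwardClosed {n} Q = ∀ {S T : Subset n} → S ⊆ T → Q S → Q T

module _ {n} (Q : Subset n → Set) (P : Permutation′ n) where

  least⇒crosses : ¬ Q (prefix P 0) → ∀ m → IsLeastIndex Q P m →
                  Crosses Q (prefix P (toℕ m)) (prefix P (suc (toℕ m)))
  least⇒crosses ¬Q∅ zero    (QB , _)       = QB , ¬Q∅
  least⇒crosses ¬Q∅ (suc k) (QB , earlier) = QB , λ QA →
    earlier (inject₁ k) (s≤s (≤-reflexive (toℕ-inject₁ k)))
            (subst (λ t → Q (prefix P (suc t))) (sym (toℕ-inject₁ k)) QA)

  crosses⇒least : UpwardClosed Q → ∀ m →
                  Crosses Q (prefix P (toℕ m)) (prefix P (suc (toℕ m))) → IsLeastIndex Q P m
  crosses⇒least up m (QB , ¬QA) = QB , λ l l<m QPl → ¬QA (up (prefix-mono P l<m) QPl)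

notSubset-upward : ∀ {n} (R : Subset n) → UpwardClosed (NotSubsetOf R)
notSubset-upward R S⊆T S⊈R T⊆R = S⊈R (⊆-trans S⊆T T⊆R)

superset-upward : ∀ {n} (R : Subset n) → UpwardClosed (SupersetOf R)
superset-upward R S⊆T R⊆S = ⊆-trans R⊆S S⊆T

notSubset-empty : ∀ {n} (R : Subset n) (P : Permutation′ n) → ¬ NotSubsetOf R (prefix P 0)
notSubset-empty R P ∅⊈R = ∅⊈R (⊥-elim ∘ prefix-empty P)

superset-empty : ∀ {n} (R : Subset n) → Nonempty R → (P : Permutation′ n) →
                 ¬ SupersetOf R (prefix P 0)
superset-empty R (r , r∈R) P R⊆∅ = prefix-empty P (R⊆∅ r∈R)

lemma4p1 : (n : ℕ) (R : Subset n) → Nonempty R → (P : Permutation′ n) → (m : Fin n) →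
    (IsLeastIndex (NotSubsetOf R) P m → lovaszGrad R P (P ⟨$⟩ʳ m) ≡ + 1)
    × (IsLeastIndex (SupersetOf R) P m → lovaszGrad R P (P ⟨$⟩ʳ m) ≡ - (+ 1))
    × (¬ IsLeastIndex (NotSubsetOf R) P m → ¬ IsLeastIndex (SupersetOf R) P m →
         lovaszGrad R P (P ⟨$⟩ʳ m) ≡ + 0)
lemma4p1 n R R≢∅ P m =
    (λ least → trans grad (jump-leave-below
                 (least⇒crosses (NotSubsetOf R) P (notSubset-empty R P) m least)))
  , (λ least → trans grad (jump-reach-above
                 (least⇒crosses (SupersetOf R) P (superset-empty R R≢∅ P) m least)))
  , λ ¬least₁ ¬least₂ → trans grad
      (jump-flat (¬least₁ ∘ crosses⇒least (NotSubsetOf R) P (notSubset-upward R) m)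
                 (¬least₂ ∘ crosses⇒least (SupersetOf R) P (superset-upward R) m))
  where
  A B : Subset n
  A = prefix P (toℕ m)
  B = prefix P (suc (toℕ m))
  open Increment R A B (prefix-mono P (n≤1+n (toℕ m)))
  open OnePoint (P ⟨$⟩ʳ m) (prefix-step P m)
  grad : lovaszGrad R P (P ⟨$⟩ʳ m) ≡ jump R A B
  grad = lovaszGrad-jump P R m
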